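{- For every $A\in Form$ and $t\in Pol$: (1) $\vdash t{:}A\to\Box\, t{:}A$; (2) $\vdash KA\to\Box KA$.
   Context: Fix a finite nonempty set $Ag$ and countably infinite disjoint sets $PVar$, $PConst$, $Var$. $Pol$: $t ::= x \mid c \mid s+t \mid s\times t \mid\ !t$. $Form$: $A ::= p \mid A\wedge B \mid \neg A \mid [j]A \mid \Box A \mid t{:}A \mid KA \mid Et$; $\Diamond=\neg\Box\neg$. $\vdash$ is derivability in $\Sigma$: axioms (A0) propositional tautologies; (A1) S5 for $\Box$ and each $[j]$; (A2) $\Box A\to[j]A$; (A3) $(\Diamond[j_1]A_1\wedge\dots\wedge\Diamond[j_n]A_n)\to\Diamond([j_1]A_1\wedge\dots\wedge[j_n]A_n)$, $j_i$ distinct; (A4) $s{:}(A\to B)\to(t{:}A\to(s\times t){:}B)$; (A5) $t{:}A\to(!t{:}(t{:}A)\wedge KA)$; (A6) $(s{:}A\vee t{:}A)\to(s+t){:}A$; (A7) S4 for $K$; (A8) $KA\to\Box K\Box A$; (A9) $\Box Et\to K\Box Et$; rules (R1) modus ponens; (R2) $A/KA$; (R3) $c{:}A$ for $A$ an instance of (A0)–(A9), $c\in PConst$; (R4) from $KA\to(\neg\Box Et_1\vee\dots\vee\neg\Box Et_n)$ infer $KA\to(\neg Et_1\vee\dots\vee\neg Et_n)$. -}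

module Defs where

open import Data.Nat using (ℕ; suc)
open import Data.Fin using (Fin)
open import Data.Bool using (Bool; true; false; not; _∧_)
open import Data.List using (List; []; _∷_; map; foldr)
open import Data.List.Relation.Unary.Unique.Propositional using (Unique)
open import Data.Product using (_×_; _,_; proj₁)
open import Relation.Binary.PropositionalEquality using (_≡_)

-- Ag: a finite nonempty set of agents, modelled as Fin (suc n).
-- PVar, PConst, Var: countably infinite, pairwise disjoint (distinct constructors over ℕ).
module Logic (n : ℕ) where

  Ag : Set
  Ag = Fin (suc n)

  data Pol : Set where
    var   : ℕ → Pol
    const : ℕ → Pol
    _⊕_   : Pol → Pol → Pol
    _⊗_   : Pol → Pol → Pol
    !_    : Pol → Pol

  data Form : Set where
    pv   : ℕ → Form
    _∧'_ : Form → Form → Form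
    ¬'_  : Form → Form
    [_]_ : Ag → Form → Form
    □_   : Form → Form
    _∶_  : Pol → Form → Form
    K_   : Form → Form
    E_   : Pol → Form

  infixr 6 _∧'_
  infix 7 ¬'_ □_ K_ [_]_ _∶_

  _∨'_ : Form → Form → Form
  A ∨' B = ¬' (¬' A ∧' ¬' B)

  _⇒_ : Form → Form → Form
  A ⇒ B = ¬' (A ∧' ¬' B)
  infixr 4 _⇒_
  infixr 5 _∨'_

  ◇_ : Form → Form
  ◇ A = ¬' □ ¬' A
  infix 7 ◇_

  -- propositional tautologies: boolean valuation treating every formula whose
  -- main connective is not ∧ or ¬ as an atom
  eval : (Form → Bool) → Form → Bool
  eval v (A ∧' B) = eval v A ∧ eval v B
  eval v (¬' A)   = not (eval v A)
  eval v A        = v A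

  Taut : Form → Set
  Taut A = (v : Form → Bool) → eval v A ≡ true

  ⋀ : List Form → Form → Form
  ⋀ []       B = B
  ⋀ (A ∷ As) B = A ∧' ⋀ As B

  A3 : (Ag × Form) → List (Ag × Form) → Form
  A3 (j , A) js =
    foldr (λ p acc → ◇ ([ proj₁ p ] Data.Product.proj₂ p) ∧' acc) (◇ ([ j ] A)) js
    ⇒ ◇ foldr (λ p acc → ([ proj₁ p ] Data.Product.proj₂ p) ∧' acc) ([ j ] A) js

  disj□ : Pol → List Pol → Form
  disj□ t ts = foldr (λ s acc → ¬' □ E s ∨' acc) (¬' □ E t) ts

  disjE : Pol → List Pol → Form
  disjE t ts = foldr (λ s acc → ¬' E s ∨' acc) (¬' E t) ts

  data Axiom : Form → Set where
    a0     : ∀ {A} → Taut A → Axiom A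
    a1□K   : ∀ {A B} → Axiom (□ (A ⇒ B) ⇒ (□ A ⇒ □ B))
    a1□T   : ∀ {A} → Axiom (□ A ⇒ A)
    a1□5   : ∀ {A} → Axiom (◇ A ⇒ □ ◇ A)
    a1jK   : ∀ {j A B} → Axiom ([ j ] (A ⇒ B) ⇒ ([ j ] A ⇒ [ j ] B))
    a1jT   : ∀ {j A} → Axiom ([ j ] A ⇒ A)
    a1j5   : ∀ {j A} → Axiom (¬' [ j ] ¬' A ⇒ [ j ] (¬' [ j ] ¬' A))
    a2     : ∀ {j A} → Axiom (□ A ⇒ [ j ] A)
    a3     : ∀ (p : Ag × Form) (ps : List (Ag × Form)) →
             Unique (map proj₁ (p ∷ ps)) → Axiom (A3 p ps)
    a4     : ∀ {s t A B} → Axiom (s ∶ (A ⇒ B) ⇒ (t ∶ A ⇒ (s ⊗ t) ∶ B))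
    a5     : ∀ {t A} → Axiom (t ∶ A ⇒ ((! t) ∶ (t ∶ A) ∧' K A))
    a6     : ∀ {s t A} → Axiom ((s ∶ A ∨' t ∶ A) ⇒ (s ⊕ t) ∶ A)
    a7K    : ∀ {A B} → Axiom (K (A ⇒ B) ⇒ (K A ⇒ K B))
    a7T    : ∀ {A} → Axiom (K A ⇒ A)
    a74    : ∀ {A} → Axiom (K A ⇒ K K A)
    a8     : ∀ {A} → Axiom (K A ⇒ □ K □ A)
    a9     : ∀ {t} → Axiom (□ E t ⇒ K □ E t)

  data ⊢_ : Form → Set where
    ax   : ∀ {A} → Axiom A → ⊢ A
    r1   : ∀ {A B} → ⊢ (A ⇒ B) → ⊢ A → ⊢ B
    -- necessitation for □ and each [j] (part of "S5 for □ / [j]")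
    nec□ : ∀ {A} → ⊢ A → ⊢ □ A
    necj : ∀ {j A} → ⊢ A → ⊢ [ j ] A
    r2   : ∀ {A} → ⊢ A → ⊢ K A
    r3   : ∀ {A} (c : ℕ) → Axiom A → ⊢ (const c ∶ A)
    r4   : ∀ {A} (t : Pol) (ts : List Pol) →
           ⊢ (K A ⇒ disj□ t ts) → ⊢ (K A ⇒ disjE t ts)

  infix 2 ⊢_

-- By (A5) twice, t : A yields !t : (t : A) and then K (t : A).  Axiom (A8)
-- gives K B ⇒ □ K □ B, and the T axiom for K strips the inner box, so
-- K B ⇒ □ K B; applied to B = t : A and followed by T for K under □, this
-- gives t : A ⇒ □ (t : A).
module Submission where

open import Defs
open import Data.Nat using (ℕ)
open import Data.Bool using (true; false)
open import Data.Product using (_×_; _,_)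
open import Relation.Binary.PropositionalEquality using (refl)

module Derivations (n : ℕ) where
  open Logic n

  ⇒-trans-taut : ∀ X Y Z → Taut ((X ⇒ Y) ⇒ ((Y ⇒ Z) ⇒ (X ⇒ Z)))
  ⇒-trans-taut X Y Z v with eval v X | eval v Y | eval v Z
  ... | true  | true  | true  = refl
  ... | true  | true  | false = refl
  ... | true  | false | true  = refl
  ... | true  | false | false = refl
  ... | false | true  | true  = refl
  ... | false | true  | false = refl
  ... | false | false | true  = refl
  ... | false | false | false = refl

  ∧-projˡ-taut : ∀ X Y → Taut ((X ∧' Y) ⇒ X)
  ∧-projˡ-taut X Y v with eval v X | eval v Y
  ... | true  | true  = refl
  ... | true  | false = refl
  ... | false | true  = refl
  ... | false | false = refl

  ∧-projʳ-taut : ∀ X Y → Taut ((X ∧' Y) ⇒ Y)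
  ∧-projʳ-taut X Y v with eval v X | eval v Y
  ... | true  | true  = refl
  ... | true  | false = refl
  ... | false | true  = refl
  ... | false | false = refl

  ⇒-trans : ∀ {X Y Z} → ⊢ (X ⇒ Y) → ⊢ (Y ⇒ Z) → ⊢ (X ⇒ Z)
  ⇒-trans {X} {Y} {Z} p q = r1 (r1 (ax (a0 (⇒-trans-taut X Y Z))) p) q

  ∧-projˡ : ∀ {X Y} → ⊢ ((X ∧' Y) ⇒ X)
  ∧-projˡ {X} {Y} = ax (a0 (∧-projˡ-taut X Y))

  ∧-projʳ : ∀ {X Y} → ⊢ ((X ∧' Y) ⇒ Y)
  ∧-projʳ {X} {Y} = ax (a0 (∧-projʳ-taut X Y))

  □-mono : ∀ {X Y} → ⊢ (X ⇒ Y) → ⊢ (□ X ⇒ □ Y)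
  □-mono p = r1 (ax a1□K) (nec□ p)

  K-mono : ∀ {X Y} → ⊢ (X ⇒ Y) → ⊢ (K X ⇒ K Y)
  K-mono p = r1 (ax a7K) (r2 p)

  K⇒□K : ∀ A → ⊢ (K A ⇒ □ (K A))
  K⇒□K A = ⇒-trans (ax a8) (□-mono (K-mono (ax a1□T)))

  ∶⇒K∶ : ∀ A t → ⊢ (t ∶ A ⇒ K (t ∶ A))
  ∶⇒K∶ A t = ⇒-trans (ax a5) (⇒-trans ∧-projˡ (⇒-trans (ax a5) ∧-projʳ))

  ∶⇒□∶ : ∀ A t → ⊢ (t ∶ A ⇒ □ (t ∶ A))
  ∶⇒□∶ A t = ⇒-trans (∶⇒K∶ A t) (⇒-trans (K⇒□K (t ∶ A)) (□-mono (ax a7T)))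

lemma2 : (n : ℕ) → let open Logic n in
    (A : Form) (t : Pol) →
    (⊢ (t ∶ A ⇒ □ (t ∶ A))) × (⊢ (K A ⇒ □ (K A)))
lemma2 n A t = ∶⇒□∶ A t , K⇒□K A
  where open Derivations n
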